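{- Let $n\ge 1$ and let $P(2n+1,1)$ be the graph with vertex set $\{u_0,\dots,u_{2n},v_0,\dots,v_{2n}\}$ and edge set $\{u_iu_{i+1}\}\cup\{v_iv_{i+1}\}\cup\{u_iv_i\}$, $i=0,\dots,2n$, indices modulo $2n+1$. Then for every $l$ with $2\le l\le 2n+1$, the number of cycles of length $2l$ in $P(2n+1,1)$ is $2n+1$, and the number of cycles of length $2n+1$ in $P(2n+1,1)$ is $2$.
   Context: Cycles are counted as subgraphs. -}

module Defs where

open import Data.Nat using (ℕ; zero; suc; _≤_; _%_)
open import Data.Nat.DivMod using (m%n<n)
open import Data.Fin using (Fin; toℕ; fromℕ<) renaming (zero to fzero; suc to fsuc)
open import Data.Bool using (Bool; true)
open import Data.Vec using (Vec; lookup)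
open import Data.List using (List; length)
open import Data.List.Membership.Propositional using (_∈_)
open import Data.List.Relation.Unary.Unique.Propositional using (Unique)
open import Data.Product using (Σ; ∃; _×_; _,_)
open import Data.Sum using (_⊎_)
open import Function.Definitions using (Injective)
open import Function.Bundles using (_⇔_)
open import Relation.Binary.PropositionalEquality using (_≡_)

next : ∀ {k} → Fin k → Fin k
next {suc k} i = fromℕ< (m%n<n (suc (toℕ i)) (suc k))

-- The prism P(m,1) (m = 2n+1 in the theorem).
-- Vertices: (0 , i) = u_i , (1 , i) = v_i.
V : ℕ → Set
V m = Fin 2 × Fin m

-- Edge names: (0 , i) = u_i u_{i+1}, (1 , i) = v_i v_{i+1}, (2 , i) = u_i v_i.
E : ℕ → Set
E m = Fin 3 × Fin m

ends : ∀ {m} → E m → V m × V m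
ends (fzero , i)                = (fzero , i) , (fzero , next i)
ends (fsuc fzero , i)           = (fsuc fzero , i) , (fsuc fzero , next i)
ends (fsuc (fsuc fzero) , i)    = (fzero , i) , (fsuc fzero , i)

Joins : ∀ {m} → E m → V m → V m → Set
Joins e x y = (ends e ≡ (x , y)) ⊎ (ends e ≡ (y , x))

Adjacent : ∀ {m} → V m → V m → Set
Adjacent x y = ∃ λ e → Joins e x y

-- A subgraph is given by its edge set: S t i = true iff edge (t , i) is present.
EdgeSet : ℕ → Set
EdgeSet m = Vec (Vec Bool m) 3

_∈E_ : ∀ {m} → E m → EdgeSet m → Set
(t , i) ∈E S = lookup (lookup S t) i ≡ true

IsCycle : ∀ m → ℕ → EdgeSet m → Set
IsCycle m k S =
  Σ (Fin k → V m) λ w →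
    (3 ≤ k)
    × Injective _≡_ _≡_ w
    × (∀ j → Adjacent (w j) (w (next j)))
    × (∀ e → (e ∈E S) ⇔ (∃ λ j → Joins e (w j) (w (next j))))

-- "the number of edge sets S satisfying P is N"
-- (P need not be proposition-valued: we count the edge sets, not witnesses)
CountIs : ∀ {m} → (EdgeSet m → Set) → ℕ → Set
CountIs {m} P N =
  Σ (List (EdgeSet m)) λ xs →
    (length xs ≡ N) × Unique xs × (∀ S → P S ⇔ (S ∈ xs))

-- Read a cycle as a closed walk and record each step as a rung crossing or a
-- step forward or backward along a layer. Since the walk closes up, it crosses
-- an even number of rungs and its forward and backward steps agree modulo M.
-- For length 2l ≤ 2M they agree exactly, as a walk of 2M steps along one layer
-- would revisit a vertex. At a time where #forward − #backward is maximal the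
-- walk must go forward, cross a rung, then go backward; the two runs leaving
-- that rung end at rungs and, by injectivity, meet after the same number of steps,
-- so the cycle is the rectangle u_P … u_{P−a} v_{P−a} … v_P with a = l − 1.
-- For the odd length M the walk must wind exactly once around, which spends all
-- M steps on one layer. Conversely every such rectangle and both layers are cycles.

module Submission where

open import Defs
open import Data.Nat
  using (ℕ; zero; suc; _+_; _*_; _∸_; _≤_; _<_; z≤n; s≤s; s≤s⁻¹; _%_; _/_; _≤?_; _<?_)
open import Data.Nat.Properties
open import Data.Nat.DivMod
open import Data.Nat.Tactic.RingSolver using (solve-∀)
open import Data.Fin using (Fin; toℕ; fromℕ<) renaming (zero to fzero; suc to fsuc)
open import Data.Fin.Properties using (toℕ-fromℕ<; toℕ-injective; toℕ<n; any?) renaming (_≟_ to _≟ᶠ_)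
open import Data.Bool using (Bool; true; false)
open import Data.Vec using (lookup; tabulate)
open import Data.Vec.Properties using (tabulate∘lookup; tabulate-cong; lookup∘tabulate)
import Data.List as List
open import Data.List using ([]; _∷_)
open import Data.List.Properties using (length-tabulate)
open import Data.List.Membership.Propositional using (_∈_)
open import Data.List.Membership.Propositional.Properties using (∈-tabulate⁺; ∈-tabulate⁻)
import Data.List.Relation.Unary.Unique.Propositional.Properties as Unique
open import Data.List.Relation.Unary.Any using (here; there)
open import Data.List.Relation.Unary.All using ([]; _∷_)
open import Data.List.Relation.Unary.AllPairs using ([]; _∷_)
open import Data.Product using (Σ; ∃; _×_; _,_; proj₁; proj₂)
open import Data.Product.Properties using (≡-dec)
open import Data.Sum using (_⊎_; inj₁; inj₂; [_,_]; [_,_]′)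
open import Data.Empty using (⊥; ⊥-elim)
open import Function.Base using (id)
open import Function.Definitions using (Injective)
open import Function.Bundles using (_⇔_; mk⇔; module Equivalence)
import Function.Properties.Equivalence as ⇔
open import Level using (0ℓ)
import Relation.Binary.Reasoning.Setoid as SetoidReasoning
open import Relation.Nullary using (¬_; Dec; yes; no; ¬?)
open import Relation.Nullary.Decidable using (⌊_⌋; _⊎-dec_; decidable-stable; toSum)
open import Relation.Binary using (tri<; tri≈; tri>)
open import Relation.Binary.PropositionalEquality hiding ([_])

-- Rotations of Fin K

module Rotation (K' : ℕ) where

  K : ℕ
  K = suc K'

  next^ : ℕ → Fin K → Fin K
  next^ zero    j = j
  next^ (suc t) j = next (next^ t j)

  toℕ-next^ : ∀ t j → toℕ (next^ t j) ≡ (toℕ j + t) % K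
  toℕ-next^ zero j = sym (trans (cong (_% K) (+-identityʳ (toℕ j))) (m<n⇒m%n≡m (toℕ<n j)))
  toℕ-next^ (suc t) j = begin
    toℕ (next (next^ t j))       ≡⟨ toℕ-fromℕ< (m%n<n (suc (toℕ (next^ t j))) K) ⟩
    suc (toℕ (next^ t j)) % K    ≡⟨ cong (λ x → suc x % K) (toℕ-next^ t j) ⟩
    suc ((toℕ j + t) % K) % K    ≡⟨ %-distribˡ-+ 1 ((toℕ j + t) % K) K ⟩
    (1 % K + (toℕ j + t) % K % K) % K ≡⟨ cong (λ z → (1 % K + z) % K) (m%n%n≡m%n (toℕ j + t) K) ⟩
    (1 % K + (toℕ j + t) % K) % K ≡⟨ %-distribˡ-+ 1 (toℕ j + t) K ⟨
    suc (toℕ j + t) % K          ≡⟨ cong (_% K) (+-suc (toℕ j) t) ⟨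
    (toℕ j + suc t) % K          ∎
    where open ≡-Reasoning

  next^-+ : ∀ a b j → next^ (a + b) j ≡ next^ a (next^ b j)
  next^-+ zero    b j = refl
  next^-+ (suc a) b j = cong next (next^-+ a b j)

  next^-comm : ∀ a b j → next^ a (next^ b j) ≡ next^ b (next^ a j)
  next^-comm a b j = trans (sym (next^-+ a b j)) (trans (cong (λ z → next^ z j) (+-comm a b)) (next^-+ b a j))

  next^-K : ∀ j → next^ K j ≡ j
  next^-K j = toℕ-injective (trans (toℕ-next^ K j) (trans ([m+n]%n≡m%n (toℕ j) K) (m<n⇒m%n≡m (toℕ<n j))))

  next^-*K : ∀ c j → next^ (c * K) j ≡ j
  next^-*K zero    j = refl
  next^-*K (suc c) j = trans (next^-+ K (c * K) j) (trans (cong (next^ K) (next^-*K c j)) (next^-K j))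

  next^-% : ∀ t j → next^ (t % K) j ≡ next^ t j
  next^-% t j = begin
    next^ (t % K) j                     ≡⟨ next^-*K (t / K) (next^ (t % K) j) ⟨
    next^ (t / K * K) (next^ (t % K) j) ≡⟨ next^-+ (t / K * K) (t % K) j ⟨
    next^ (t / K * K + t % K) j         ≡⟨ cong (λ z → next^ z j) (trans (+-comm (t / K * K) (t % K)) (sym (m≡m%n+[m/n]*n t K))) ⟩
    next^ t j                           ∎
    where open ≡-Reasoning

  next^-fromZero : ∀ j → next^ (toℕ j) fzero ≡ j
  next^-fromZero j = toℕ-injective (trans (toℕ-next^ (toℕ j) fzero) (m<n⇒m%n≡m (toℕ<n j)))

  next^-≢ : ∀ d j → 0 < d → d < K → next^ d j ≢ j
  next^-≢ d j 0<d d<K eq with toℕ j + d <? K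
  ... | yes j+d<K = >⇒≢ (m<m+n (toℕ j) 0<d) (begin
    toℕ j + d         ≡⟨ m<n⇒m%n≡m j+d<K ⟨
    (toℕ j + d) % K   ≡⟨ toℕ-next^ d j ⟨
    toℕ (next^ d j)   ≡⟨ cong toℕ eq ⟩
    toℕ j             ∎)
    where open ≡-Reasoning
  ... | no j+d≮K = <⇒≢ wrapped<j (begin
    toℕ j + d ∸ K     ≡⟨ m<n⇒m%n≡m (+-cancelʳ-< _ _ _ (subst (_< K + K) (sym (m∸n+n≡m K≤j+d)) (+-mono-< (toℕ<n j) d<K))) ⟨
    (toℕ j + d ∸ K) % K ≡⟨ m≤n⇒[n∸m]%m≡n%m K≤j+d ⟩
    (toℕ j + d) % K   ≡⟨ toℕ-next^ d j ⟨
    toℕ (next^ d j)   ≡⟨ cong toℕ eq ⟩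
    toℕ j             ∎)
    where
      open ≡-Reasoning
      K≤j+d : K ≤ toℕ j + d
      K≤j+d = ≮⇒≥ j+d≮K
      wrapped<j : toℕ j + d ∸ K < toℕ j
      wrapped<j = +-cancelʳ-< _ _ _ (subst (_< toℕ j + K) (sym (m∸n+n≡m K≤j+d)) (+-monoʳ-< (toℕ j) d<K))

  next^-<-≢ : ∀ {a b} j → a < b → b < K → next^ a j ≢ next^ b j
  next^-<-≢ {a} {b} j a<b b<K e = next^-≢ (b ∸ a) (next^ a j) (m<n⇒0<n∸m a<b) (≤-<-trans (m∸n≤m b a) b<K)
    (trans (sym (next^-+ (b ∸ a) a j)) (trans (cong (λ z → next^ z j) (m∸n+n≡m (<⇒≤ a<b))) (sym e)))

  next^-injective : ∀ {t t'} j → t < K → t' < K → next^ t j ≡ next^ t' j → t ≡ t'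
  next^-injective {t} {t'} j t<K t'<K eq with <-cmp t t'
  ... | tri≈ _ t≡t' _ = t≡t'
  ... | tri< t<t' _ _ = ⊥-elim (next^-<-≢ j t<t' t'<K eq)
  ... | tri> _ _ t'<t = ⊥-elim (next^-<-≢ j t'<t t<K (sym eq))

  next^-surjective : ∀ j j' → ∃ λ t → t < K × next^ t j ≡ j'
  next^-surjective j j' = t % K , m%n<n t K , trans (next^-% t j) reaches
    where
      open ≡-Reasoning
      t : ℕ
      t = toℕ j' + (K ∸ toℕ j)
      reaches : next^ t j ≡ j'
      reaches = begin
        next^ t j                          ≡⟨ cong (next^ t) (next^-fromZero j) ⟨
        next^ t (next^ (toℕ j) fzero)      ≡⟨ next^-+ t (toℕ j) fzero ⟨
        next^ (t + toℕ j) fzero            ≡⟨ cong (λ z → next^ z fzero) (trans (+-assoc (toℕ j') (K ∸ toℕ j) (toℕ j))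
                                                (cong (toℕ j' +_) (m∸n+n≡m (<⇒≤ (toℕ<n j))))) ⟩
        next^ (toℕ j' + K) fzero           ≡⟨ next^-+ (toℕ j') K fzero ⟩
        next^ (toℕ j') (next^ K fzero)     ≡⟨ cong (next^ (toℕ j')) (next^-K fzero) ⟩
        next^ (toℕ j') fzero               ≡⟨ next^-fromZero j' ⟩
        j'                                 ∎

  next^-period⇒multiple : ∀ a d j → next^ (d + a) j ≡ next^ a j → ∃ λ c → d ≡ c * K
  next^-period⇒multiple a d j eq with d % K ≟ 0
  ... | yes d%K≡0 = d / K , trans (m≡m%n+[m/n]*n d K) (cong (_+ d / K * K) d%K≡0)
  ... | no d%K≢0  = ⊥-elim (next^-≢ (d % K) (next^ a j) (n≢0⇒n>0 d%K≢0) (m%n<n d K)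
                      (trans (next^-% d (next^ a j)) (trans (sym (next^-+ d a j)) eq)))

  prev : Fin K → Fin K
  prev = next^ K'

  next-prev : ∀ p → next (prev p) ≡ p
  next-prev = next^-K

  prev-next : ∀ p → prev (next p) ≡ p
  prev-next p = trans (sym (next^-+ K' 1 p)) (trans (cong (λ z → next^ z p) (+-comm K' 1)) (next^-K p))

  next-injective : ∀ {p q} → next p ≡ next q → p ≡ q
  next-injective {p} {q} e = trans (sym (prev-next p)) (trans (cong prev e) (prev-next q))

  prev^ : ℕ → Fin K → Fin K
  prev^ zero    p = p
  prev^ (suc u) p = prev (prev^ u p)

  next^-prev^ : ∀ u p → next^ u (prev^ u p) ≡ p
  next^-prev^ zero    p = refl
  next^-prev^ (suc u) p = begin
    next^ (suc u) (prev (prev^ u p))   ≡⟨ next^-comm 1 u (prev (prev^ u p)) ⟩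
    next^ u (next (prev (prev^ u p)))  ≡⟨ cong (next^ u) (next-prev (prev^ u p)) ⟩
    next^ u (prev^ u p)                ≡⟨ next^-prev^ u p ⟩
    p                                  ∎
    where open ≡-Reasoning

  prev^-next^ : ∀ u p → prev^ u (next^ u p) ≡ p
  prev^-next^ zero    p = refl
  prev^-next^ (suc u) p = begin
    prev (prev^ u (next (next^ u p)))  ≡⟨ cong (λ z → prev (prev^ u z)) (next^-comm 1 u p) ⟩
    prev (prev^ u (next^ u (next p)))  ≡⟨ cong prev (prev^-next^ u (next p)) ⟩
    prev (next p)                      ≡⟨ prev-next p ⟩
    p                                  ∎
    where open ≡-Reasoning

  prev^-K : ∀ p → prev^ K p ≡ p
  prev^-K p = trans (cong (prev^ K) (sym (next^-K p))) (prev^-next^ K p)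

  prev^-injective : ∀ {u u'} p → u < K → u' < K → prev^ u p ≡ prev^ u' p → u ≡ u'
  prev^-injective {u} {u'} p u<K u'<K e = next^-injective (prev^ u p) u<K u'<K
    (trans (next^-prev^ u p) (sym (trans (cong (next^ u') e) (next^-prev^ u' p))))

  ∃-next⇔∃-next^ : ∀ {A : Set} (w : Fin K → A) (R : A → A → Set) j0 →
                   (∃ λ j → R (w j) (w (next j))) ⇔ (∃ λ t → t < K × R (w (next^ t j0)) (w (next^ (suc t) j0)))
  ∃-next⇔∃-next^ w R j0 = mk⇔ to (λ { (t , _ , r) → next^ t j0 , r })
    where
      to : (∃ λ j → R (w j) (w (next j))) → ∃ λ t → t < K × R (w (next^ t j0)) (w (next^ (suc t) j0))
      to (j , r) with next^-surjective j0 j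
      ... | t , t<K , refl = t , t<K , r

-- Winding numbers

odd≢even : ∀ a b → suc (a + a) ≢ b + b
odd≢even a       zero    ()
odd≢even zero    (suc b) e = 0≢1+n (trans (suc-injective e) (+-suc b b))
odd≢even (suc a) (suc b) e = odd≢even a b (suc-injective (trans (sym (+-suc (suc a) a)) (trans (suc-injective e) (+-suc b b))))

+-double-injective : ∀ x y → x + x ≡ y + y → x ≡ y
+-double-injective zero    zero    e = refl
+-double-injective (suc x) (suc y) e = cong suc (+-double-injective x y
  (suc-injective (trans (sym (+-suc x x)) (trans (suc-injective e) (+-suc y y)))))

double+double≡0 : ∀ h X → h + h + X + X ≡ 0 → h ≡ 0 × X ≡ 0
double+double≡0 h X e = m+n≡0⇒m≡0 h (m+n≡0⇒m≡0 (h + h) (m+n≡0⇒m≡0 (h + h + X) e)) , m+n≡0⇒n≡0 (h + h + X) e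

-- Length of a closed walk with 2h rung steps, X steps one way around the M-gon
-- and c M + X steps the other way; c is its winding number.
module Windings (n : ℕ) where

  M : ℕ
  M = suc (2 * n)

  private
    regroup : ∀ h X d → h + h + X + (d + X) ≡ h + h + X + X + d
    regroup = solve-∀

    M<2+c*M : ∀ c → M < suc (suc c) * M
    M<2+c*M c = m<m+n M {suc c * M} (s≤s z≤n)

  winding-number-even : ∀ h X c l → h + h + X + (c * M + X) ≡ l + l → l ≤ M →
                        c ≡ 0 ⊎ (h ≡ 0 × X ≡ 0 × c ≡ 2)
  winding-number-even h X zero l e l≤M = inj₁ refl
  winding-number-even h X (suc zero) l e l≤M = ⊥-elim (odd≢even (h + X + n) l (trans (odd h X n) e))
    where
      odd : ∀ h X n → suc ((h + X + n) + (h + X + n)) ≡ h + h + X + ((suc (2 * n) + 0) + X)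
      odd = solve-∀
  winding-number-even h X (suc (suc zero)) l e l≤M = inj₂ (proj₁ h,X≡0 , proj₂ h,X≡0 , refl)
    where
      rest≤0 : h + h + X + X + (M + M) ≤ 0 + (M + M)
      rest≤0 = subst (_≤ M + M) (trans (sym e) (trans (regroup h X (2 * M)) (cong (h + h + X + X +_) (cong (M +_) (+-identityʳ M)))))
                 (+-mono-≤ l≤M l≤M)
      h,X≡0 : h ≡ 0 × X ≡ 0
      h,X≡0 = double+double≡0 h X (n≤0⇒n≡0 (+-cancelʳ-≤ (M + M) _ _ rest≤0))
  winding-number-even h X (suc (suc (suc c))) l e l≤M = ⊥-elim (<-irrefl refl (begin-strict
    M + M                         <⟨ +-monoʳ-< M (M<2+c*M c) ⟩
    3+c*M                         ≤⟨ m≤n+m 3+c*M (h + h + X + X) ⟩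
    h + h + X + X + 3+c*M         ≡⟨ regroup h X 3+c*M ⟨
    h + h + X + (3+c*M + X)       ≡⟨ e ⟩
    l + l                         ≤⟨ +-mono-≤ l≤M l≤M ⟩
    M + M                         ∎))
    where
      open ≤-Reasoning
      3+c*M : ℕ
      3+c*M = suc (suc (suc c)) * M

  winding-number-odd : ∀ h X c → h + h + X + (c * M + X) ≡ M → h ≡ 0 × X ≡ 0 × c ≡ 1
  winding-number-odd h X zero e = ⊥-elim (odd≢even n (h + X) (trans (M-odd n) (trans (sym e) (pair h X))))
    where
      M-odd : ∀ n → suc (n + n) ≡ suc (2 * n)
      M-odd = solve-∀
      pair : ∀ h X → h + h + X + X ≡ h + X + (h + X)
      pair = solve-∀
  winding-number-odd h X (suc zero) e = proj₁ h,X≡0 , proj₂ h,X≡0 , refl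
    where
      h,X≡0 : h ≡ 0 × X ≡ 0
      h,X≡0 = double+double≡0 h X (+-cancelʳ-≡ M (h + h + X + X) 0
                (trans (sym (trans (regroup h X (M + 0)) (cong (h + h + X + X +_) (+-identityʳ M)))) e))
  winding-number-odd h X (suc (suc c)) e = ⊥-elim (<-irrefl refl (begin-strict
    M                             <⟨ M<2+c*M c ⟩
    2+c*M                         ≤⟨ m≤n+m 2+c*M (h + h + X + X) ⟩
    h + h + X + X + 2+c*M         ≡⟨ regroup h X 2+c*M ⟨
    h + h + X + (2+c*M + X)       ≡⟨ e ⟩
    M                             ∎))
    where
      open ≤-Reasoning
      2+c*M : ℕ
      2+c*M = suc (suc c) * M

other : Fin 2 → Fin 2
other fzero        = fsuc fzero
other (fsuc fzero) = fzero

other-involutive : ∀ s → other (other s) ≡ s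
other-involutive fzero        = refl
other-involutive (fsuc fzero) = refl

other-≢ : ∀ s → other s ≢ s
other-≢ fzero        ()
other-≢ (fsuc fzero) ()

layer-cases : ∀ s' s → s' ≡ s ⊎ s' ≡ other s
layer-cases fzero        fzero        = inj₁ refl
layer-cases fzero        (fsuc fzero) = inj₂ refl
layer-cases (fsuc fzero) fzero        = inj₂ refl
layer-cases (fsuc fzero) (fsuc fzero) = inj₁ refl

other^ : ℕ → Fin 2 → Fin 2
other^ zero    s = s
other^ (suc c) s = other (other^ c s)

other^-fixed⇒even : ∀ c s → other^ c s ≡ s → ∃ λ h → c ≡ h + h
other^-fixed⇒even c s = proj₁ (parity c)
  where
    parity : ∀ c → (other^ c s ≡ s → ∃ λ h → c ≡ h + h) × (other^ c s ≡ other s → ∃ λ h → c ≡ suc (h + h))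
    parity zero    = (λ _ → 0 , refl) , λ e → ⊥-elim (other-≢ s (sym e))
    parity (suc c) =
      (λ e → let h , c≡ = proj₂ (parity c) (trans (sym (other-involutive _)) (cong other e))
             in suc h , cong suc (trans c≡ (sym (+-suc h h))))
      , λ e → let h , c≡ = proj₁ (parity c) (trans (sym (other-involutive _)) (trans (cong other e) (other-involutive s)))
              in h , cong suc c≡

rim : Fin 2 → Fin 3
rim fzero        = fzero
rim (fsuc fzero) = fsuc fzero

rung : Fin 3
rung = fsuc (fsuc fzero)

rim≢rung : ∀ s → rim s ≢ rung
rim≢rung fzero        ()
rim≢rung (fsuc fzero) ()

least-witness : (P : ℕ → Set) → (∀ u → Dec (P u)) → ∀ N → P N →
                ∃ λ u → u ≤ N × P u × (∀ u' → u' < u → ¬ P u')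
least-witness P P? N PN with search N
  where
    search : ∀ N → (∃ λ u → u ≤ N × P u × (∀ u' → u' < u → ¬ P u')) ⊎ (∀ u → u ≤ N → ¬ P u)
    search zero with P? zero
    ... | yes P0 = inj₁ (zero , z≤n , P0 , λ _ ())
    ... | no ¬P0 = inj₂ λ { .zero z≤n → ¬P0 }
    search (suc N) with search N
    ... | inj₁ (u , u≤N , Pu , least) = inj₁ (u , m≤n⇒m≤1+n u≤N , Pu , least)
    ... | inj₂ none with P? (suc N)
    ...   | yes PN = inj₁ (suc N , ≤-refl , PN , λ u' u'<1+N → none u' (s≤s⁻¹ u'<1+N))
    ...   | no ¬PN = inj₂ λ u u≤1+N → [ (λ u<1+N → none u (s≤s⁻¹ u<1+N)) , (λ { refl → ¬PN }) ] (m≤n⇒m<n∨m≡n u≤1+N)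
... | inj₁ found = found
... | inj₂ none  = ⊥-elim (none N ≤-refl PN)

⌊⌋≡true⇔ : ∀ {Q : Set} (Q? : Dec Q) → (⌊ Q? ⌋ ≡ true) ⇔ Q
⌊⌋≡true⇔ (yes q)  = mk⇔ (λ _ → q) (λ _ → refl)
⌊⌋≡true⇔ (no ¬q) = mk⇔ (λ ()) (λ q → ⊥-elim (¬q q))

edgeSetOf : ∀ {m} (P : E m → Set) → (∀ e → Dec (P e)) → EdgeSet m
edgeSetOf P P? = tabulate (λ t → tabulate (λ i → ⌊ P? (t , i) ⌋))

∈E-edgeSetOf : ∀ {m} (P : E m → Set) (P? : ∀ e → Dec (P e)) e → (e ∈E edgeSetOf P P?) ⇔ P e
∈E-edgeSetOf P P? (t , i) = subst (λ b → (b ≡ true) ⇔ P (t , i)) (sym entry) (⌊⌋≡true⇔ (P? (t , i)))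
  where
    entry : lookup (lookup (edgeSetOf P P?) t) i ≡ ⌊ P? (t , i) ⌋
    entry = trans (cong (λ v → lookup v i) (lookup∘tabulate (λ t → tabulate (λ i → ⌊ P? (t , i) ⌋)) t))
                  (lookup∘tabulate (λ i → ⌊ P? (t , i) ⌋) i)

EdgeSet-ext : ∀ {m} (S S' : EdgeSet m) → (∀ e → (e ∈E S) ⇔ (e ∈E S')) → S ≡ S'
EdgeSet-ext S S' same = begin
  S                                                       ≡⟨ tabulate∘lookup S ⟨
  tabulate (λ t → lookup S t)                             ≡⟨ tabulate-cong row ⟩
  tabulate (λ t → lookup S' t)                            ≡⟨ tabulate∘lookup S' ⟩
  S'                                                      ∎
  where
    open ≡-Reasoning
    bool-ext : ∀ {b b' : Bool} → (b ≡ true ⇔ b' ≡ true) → b ≡ b'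
    bool-ext {true}  {true}  h = refl
    bool-ext {false} {false} h = refl
    bool-ext {true}  {false} h = sym (Equivalence.to h refl)
    bool-ext {false} {true}  h = Equivalence.from h refl
    row : ∀ t → lookup S t ≡ lookup S' t
    row t = trans (sym (tabulate∘lookup (lookup S t)))
              (trans (tabulate-cong (λ i → bool-ext (same (t , i)))) (tabulate∘lookup (lookup S' t)))

module Prism (n : ℕ) (1≤n : 1 ≤ n) where

  open Rotation (2 * n) public
  open Windings n public
  module ⇔-Reasoning = SetoidReasoning (⇔.⇔-setoid 0ℓ)

  2<M : 2 < M
  2<M = s≤s (*-monoʳ-≤ 2 1≤n)

  next²-≢ : ∀ p → next (next p) ≢ p
  next²-≢ p = next^-≢ 2 p (s≤s z≤n) 2<M

  Vertex : Set
  Vertex = V M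

  Edge : Set
  Edge = E M

  cross : Vertex → Vertex
  cross (s , p) = other s , p

  advance : Vertex → Vertex
  advance (s , p) = s , next p

  cross-involutive : ∀ x → cross (cross x) ≡ x
  cross-involutive (s , p) = cong (_, p) (other-involutive s)

  advance-injective : ∀ {x y} → advance x ≡ advance y → x ≡ y
  advance-injective {s , p} {s' , p'} e = cong₂ _,_ (cong proj₁ e) (next-injective (cong proj₂ e))

  advance≡⇒ : ∀ {x s q} → advance x ≡ (s , q) → x ≡ (s , prev q)
  advance≡⇒ {s , p} refl = cong (s ,_) (sym (prev-next p))

  data Move : Set where
    across forward backward : Move

  _≟ᵐ_ : (σ τ : Move) → Dec (σ ≡ τ)
  across   ≟ᵐ across   = yes refl
  forward  ≟ᵐ forward  = yes refl
  backward ≟ᵐ backward = yes refl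
  across   ≟ᵐ forward  = no λ ()
  across   ≟ᵐ backward = no λ ()
  forward  ≟ᵐ across   = no λ ()
  forward  ≟ᵐ backward = no λ ()
  backward ≟ᵐ across   = no λ ()
  backward ≟ᵐ forward  = no λ ()

  Moves : Move → Vertex → Vertex → Set
  Moves across   x y = y ≡ cross x
  Moves forward  x y = y ≡ advance x
  Moves backward x y = x ≡ advance y

  ends-rim : ∀ s i → ends {M} (rim s , i) ≡ ((s , i) , (s , next i))
  ends-rim fzero        i = refl
  ends-rim (fsuc fzero) i = refl

  edge-cases : ∀ (e : Edge) → (∃ λ s → ∃ λ i → e ≡ (rim s , i)) ⊎ (∃ λ i → e ≡ (rung , i))
  edge-cases (fzero , i)               = inj₁ (fzero , i , refl)
  edge-cases (fsuc fzero , i)          = inj₁ (fsuc fzero , i , refl)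
  edge-cases (fsuc (fsuc fzero) , i)   = inj₂ (i , refl)

  Joins-sym : ∀ {e : Edge} {x y} → Joins e x y → Joins e y x
  Joins-sym (inj₁ a) = inj₂ a
  Joins-sym (inj₂ a) = inj₁ a

  joins-forward : ∀ s p (e : Edge) → Joins e (s , p) (s , next p) ⇔ (e ≡ (rim s , p))
  joins-forward s p e = mk⇔ to λ { refl → inj₁ (ends-rim s p) }
    where
      to : Joins e (s , p) (s , next p) → e ≡ (rim s , p)
      to J with edge-cases e
      to J | inj₁ (s' , i , refl) with subst (λ z → (z ≡ ((s , p) , (s , next p))) ⊎ (z ≡ ((s , next p) , (s , p)))) (ends-rim s' i) J
      ... | inj₁ q = cong₂ _,_ (cong (λ z → rim (proj₁ (proj₁ z))) q) (cong (λ z → proj₂ (proj₁ z)) q)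
      ... | inj₂ q = ⊥-elim (next²-≢ p (trans (cong (λ z → next (proj₂ (proj₁ z))) (sym q)) (cong (λ z → proj₂ (proj₂ z)) q)))
      to (inj₁ q) | inj₂ (i , refl) =
        ⊥-elim (other-≢ fzero (trans (cong (λ z → proj₁ (proj₂ z)) q) (sym (cong (λ z → proj₁ (proj₁ z)) q))))
      to (inj₂ q) | inj₂ (i , refl) =
        ⊥-elim (other-≢ fzero (trans (cong (λ z → proj₁ (proj₂ z)) q) (sym (cong (λ z → proj₁ (proj₁ z)) q))))

  joins-backward : ∀ s p (e : Edge) → Joins e (s , next p) (s , p) ⇔ (e ≡ (rim s , p))
  joins-backward s p e = mk⇔ (λ J → Equivalence.to (joins-forward s p e) (Joins-sym J))
                             (λ q → Joins-sym (Equivalence.from (joins-forward s p e) q))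

  joins-across : ∀ s p (e : Edge) → Joins e (s , p) (other s , p) ⇔ (e ≡ (rung , p))
  joins-across s p e = mk⇔ to (from s)
    where
      to : Joins e (s , p) (other s , p) → e ≡ (rung , p)
      to J with edge-cases e
      to J | inj₁ (s' , i , refl) with subst (λ z → (z ≡ ((s , p) , (other s , p))) ⊎ (z ≡ ((other s , p) , (s , p)))) (ends-rim s' i) J
      ... | inj₁ q = ⊥-elim (other-≢ s (trans (sym (cong (λ z → proj₁ (proj₂ z)) q)) (cong (λ z → proj₁ (proj₁ z)) q)))
      ... | inj₂ q = ⊥-elim (other-≢ s (trans (sym (cong (λ z → proj₁ (proj₁ z)) q)) (cong (λ z → proj₁ (proj₂ z)) q)))
      to (inj₁ q) | inj₂ (i , refl) = cong (rung ,_) (cong (λ z → proj₂ (proj₁ z)) q)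
      to (inj₂ q) | inj₂ (i , refl) = cong (rung ,_) (cong (λ z → proj₂ (proj₁ z)) q)
      from : ∀ s → e ≡ (rung , p) → Joins e (s , p) (other s , p)
      from fzero        refl = inj₁ refl
      from (fsuc fzero) refl = inj₂ refl

  adjacent⇒move : ∀ {x y} → Adjacent x y → Σ Move λ σ → Moves σ x y
  adjacent⇒move {x} {y} (e , J) with edge-cases e
  adjacent⇒move {x} {y} (e , J) | inj₁ (s' , i , refl) with subst (λ z → (z ≡ (x , y)) ⊎ (z ≡ (y , x))) (ends-rim s' i) J
  ... | inj₁ q = forward  , trans (sym (cong proj₂ q)) (cong advance (cong proj₁ q))
  ... | inj₂ q = backward , trans (sym (cong proj₂ q)) (cong advance (cong proj₁ q))
  adjacent⇒move (e , inj₁ q) | inj₂ (i , refl) = across , trans (sym (cong proj₂ q)) (cong cross (cong proj₁ q))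
  adjacent⇒move (e , inj₂ q) | inj₂ (i , refl) = across , trans (sym (cong proj₁ q)) (cong cross (cong proj₂ q))

  winding-number : ∀ {X Y} p → X ≤ Y → next^ X p ≡ next^ Y p → ∃ λ c → Y ≡ c * M + X
  winding-number {X} {Y} p X≤Y e with next^-period⇒multiple X (Y ∸ X) p (trans (cong (λ z → next^ z p) (m∸n+n≡m X≤Y)) (sym e))
  ... | c , Y∸X≡c*M = c , trans (sym (m∸n+n≡m X≤Y)) (cong (_+ X) Y∸X≡c*M)

  even-closure : ∀ h X Y l p → X ≤ Y → next^ X p ≡ next^ Y p → h + h + X + Y ≡ l + l → l ≤ M →
                 X ≡ Y ⊎ (h ≡ 0 × X ≡ 0 × h + h + X + Y ≡ M + M)
  even-closure h X Y l p X≤Y e sum l≤M with winding-number p X≤Y e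
  ... | c , refl with winding-number-even h X c l sum l≤M
  ...   | inj₁ refl = inj₁ refl
  ...   | inj₂ (refl , refl , refl) = inj₂ (refl , refl , trans (+-identityʳ (2 * M)) (cong (M +_) (+-identityʳ M)))

  odd-closure : ∀ h X Y p → X ≤ Y → next^ X p ≡ next^ Y p → h + h + X + Y ≡ M → h ≡ 0 × X ≡ 0
  odd-closure h X Y p X≤Y e sum with winding-number p X≤Y e
  ... | c , refl with winding-number-odd h X c sum
  ...   | h≡0 , X≡0 , _ = h≡0 , X≡0

  record RectangleWalk (W : ℕ → Vertex) (k a : ℕ) (s : Fin 2) (P : Fin M) : Set where
    field
      length≡ : k ≡ suc (suc (a + a))
      start   : W 0 ≡ (s , P)
      up      : ∀ u → u ≤ a → W (suc u) ≡ (other s , prev^ u P)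
      down    : ∀ v → v ≤ a → W (k ∸ v) ≡ (s , prev^ v P)

  -- Closed walks

  module ClosedWalk (k' : ℕ) (w : Fin (suc k') → Vertex) (3≤k : 3 ≤ suc k')
                    (w-injective : Injective _≡_ _≡_ w) (adj : ∀ j → Adjacent (w j) (w (next j))) where

    module C = Rotation k'

    k : ℕ
    k = suc k'

    moveAt : Fin k → Move
    moveAt j = proj₁ (adjacent⇒move (adj j))

    module From (j0 : Fin k) where

      W : ℕ → Vertex
      W t = w (C.next^ t j0)

      move : ℕ → Move
      move t = moveAt (C.next^ t j0)

      moves : ∀ t → Moves (move t) (W t) (W (suc t))
      moves t = proj₂ (adjacent⇒move (adj (C.next^ t j0)))

      moves-as : ∀ {σ} t → move t ≡ σ → Moves σ (W t) (W (suc t))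
      moves-as t e = subst (λ σ → Moves σ (W t) (W (suc t))) e (moves t)

      W-injective : ∀ {t t'} → t < k → t' < k → W t ≡ W t' → t ≡ t'
      W-injective t<k t'<k e = C.next^-injective j0 t<k t'<k (w-injective e)

      shift-k : ∀ t → C.next^ (t + k) j0 ≡ C.next^ t j0
      shift-k t = trans (C.next^-+ t k j0) (cong (C.next^ t) (C.next^-K j0))

      move-period : ∀ t → move (t + k) ≡ move t
      move-period t = cong moveAt (shift-k t)

      W-k : W k ≡ W 0
      W-k = cong w (shift-k 0)

      W²-≢ : ∀ t → W (suc (suc t)) ≢ W t
      W²-≢ t e = C.next^-≢ 2 (C.next^ t j0) (s≤s z≤n) 3≤k (trans (sym (C.next^-+ 2 t j0)) (w-injective e))

      no-across-across : ∀ t → move t ≡ across → move (suc t) ≢ across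
      no-across-across t a b = W²-≢ t (trans (moves-as (suc t) b) (trans (cong cross (moves-as t a)) (cross-involutive _)))

      no-forward-backward : ∀ t → move t ≡ forward → move (suc t) ≢ backward
      no-forward-backward t a b = W²-≢ t (sym (advance-injective (trans (sym (moves-as t a)) (moves-as (suc t) b))))

      no-backward-forward : ∀ t → move t ≡ backward → move (suc t) ≢ forward
      no-backward-forward t a b = W²-≢ t (trans (moves-as (suc t) b) (sym (moves-as t a)))

      hits : Move → Move → ℕ
      hits σ τ with σ ≟ᵐ τ
      ... | yes _ = 1
      ... | no _  = 0

      count : Move → ℕ → ℕ
      count σ zero    = 0
      count σ (suc t) = hits (move t) σ + count σ t

      #R #F #B : ℕ → ℕ
      #R = count across
      #F = count forward
      #B = count backward

      count-total : ∀ t → #R t + #F t + #B t ≡ t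
      count-total zero = refl
      count-total (suc t) with move t
      ... | across   = cong suc (count-total t)
      ... | forward  = trans (+-suc-middle (#R t) (#F t) (#B t)) (cong suc (count-total t))
        where
          +-suc-middle : ∀ a b c → a + suc b + c ≡ suc (a + b + c)
          +-suc-middle = solve-∀
      ... | backward = trans (+-suc (#R t + #F t) (#B t)) (cong suc (count-total t))

      count-mono : ∀ σ d t → count σ t ≤ count σ (d + t)
      count-mono σ zero    t = ≤-refl
      count-mono σ (suc d) t = ≤-trans (count-mono σ d t) (m≤n+m _ (hits (move (d + t)) σ))

      count-period : ∀ σ t → count σ (t + k) ≡ count σ t + count σ k
      count-period σ zero    = refl
      count-period σ (suc t) = trans (cong₂ (λ τ c → hits τ σ + c) (move-period t) (count-period σ t))
                                     (sym (+-assoc (hits (move t) σ) (count σ t) (count σ k)))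

      count-vanishes : ∀ σ → count σ k ≡ 0 → ∀ t → t ≤ k → count σ t ≡ 0
      count-vanishes σ e t t≤k = n≤0⇒n≡0 (≤-trans (count-mono σ (k ∸ t) t) (≤-reflexive (trans (cong (count σ) (m∸n+n≡m t≤k)) e)))

      s0 : Fin 2
      s0 = proj₁ (W 0)

      p0 : Fin M
      p0 = proj₂ (W 0)

      position : ∀ t → W t ≡ (other^ (#R t) s0 , next^ (#F t) (prev^ (#B t) p0))
      position zero = refl
      position (suc t) with move t | moves t
      ... | across   | m = trans m (cong cross (position t))
      ... | forward  | m = trans m (cong advance (position t))
      ... | backward | m = trans (advance≡⇒ (trans (sym m) (position t)))
                                 (cong (other^ (#R t) s0 ,_) (next^-comm (2 * n) (#F t) _))

      closes : (other^ (#R k) s0 , next^ (#F k) (prev^ (#B k) p0)) ≡ (s0 , p0)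
      closes = trans (sym (position k)) W-k

      #R-even : ∃ λ h → #R k ≡ h + h
      #R-even = other^-fixed⇒even (#R k) s0 (cong proj₁ closes)

      #F≡#B-mod : next^ (#F k) p0 ≡ next^ (#B k) p0
      #F≡#B-mod = begin
        next^ (#F k) p0                               ≡⟨ cong (next^ (#F k)) (next^-prev^ (#B k) p0) ⟨
        next^ (#F k) (next^ (#B k) (prev^ (#B k) p0)) ≡⟨ next^-comm (#F k) (#B k) _ ⟩
        next^ (#B k) (next^ (#F k) (prev^ (#B k) p0)) ≡⟨ cong (next^ (#B k)) (cong proj₂ closes) ⟩
        next^ (#B k) p0                               ∎
        where open ≡-Reasoning

      forward-only : #R k ≡ 0 → #B k ≡ 0 → ∀ t → t ≤ k → W t ≡ (s0 , next^ t p0)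
      forward-only R0 B0 t t≤k = trans (position t) (cong₂ _,_ (cong (λ r → other^ r s0) R0t)
        (trans (cong (λ b → next^ (#F t) (prev^ b p0)) B0t) (cong (λ f → next^ f p0) F≡t)))
        where
          R0t : #R t ≡ 0
          R0t = count-vanishes across R0 t t≤k
          B0t : #B t ≡ 0
          B0t = count-vanishes backward B0 t t≤k
          F≡t : #F t ≡ t
          F≡t = trans (sym (trans (cong₂ (λ r b → r + #F t + b) R0t B0t) (+-identityʳ (#F t)))) (count-total t)

      backward-only : #R k ≡ 0 → #F k ≡ 0 → ∀ t → t ≤ k → W t ≡ (s0 , prev^ t p0)
      backward-only R0 F0 t t≤k = trans (position t) (cong₂ _,_ (cong (λ r → other^ r s0) R0t)
        (trans (cong (λ f → next^ f (prev^ (#B t) p0)) F0t) (cong (λ b → prev^ b p0) B≡t)))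
        where
          R0t : #R t ≡ 0
          R0t = count-vanishes across R0 t t≤k
          F0t : #F t ≡ 0
          F0t = count-vanishes forward F0 t t≤k
          B≡t : #B t ≡ t
          B≡t = trans (sym (cong₂ (λ r f → r + f + #B t) R0t F0t)) (count-total t)

      one-layer-short : #R k ≡ 0 → #B k ≡ 0 ⊎ #F k ≡ 0 → k ≤ M
      one-layer-short R0 one with M <? k
      ... | no M≮k = ≮⇒≥ M≮k
      ... | yes M<k = ⊥-elim (1+n≢0 (W-injective M<k (s≤s z≤n) returns))
        where
          returns : W M ≡ W 0
          returns = [ (λ B0 → trans (forward-only R0 B0 M (<⇒≤ M<k)) (cong (s0 ,_) (next^-K p0)))
                    , (λ F0 → trans (backward-only R0 F0 M (<⇒≤ M<k)) (cong (s0 ,_) (prev^-K p0))) ] one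

      split : ∀ h → #R k ≡ h + h → h + h + #F k + #B k ≡ k
      split h R≡ = trans (cong (λ r → r + #F k + #B k) (sym R≡)) (count-total k)

      split-swapped : ∀ h → #R k ≡ h + h → h + h + #B k + #F k ≡ k
      split-swapped h R≡ = trans (trans (+-assoc (h + h) (#B k) (#F k)) (trans (cong (h + h +_) (+-comm (#B k) (#F k)))
                                     (sym (+-assoc (h + h) (#F k) (#B k))))) (split h R≡)

      around-twice : #R k ≡ 0 → #B k ≡ 0 ⊎ #F k ≡ 0 → k ≢ M + M
      around-twice R0 one k≡2M = <⇒≱ (m<m+n M {M} (s≤s z≤n)) (subst (_≤ M) k≡2M (one-layer-short R0 one))

      closing-even : ∀ l → k ≡ l + l → l ≤ M → #F k ≡ #B k
      closing-even l k≡l+l l≤M with #R-even | ≤-total (#F k) (#B k)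
      ... | h , R≡ | inj₁ F≤B with even-closure h (#F k) (#B k) l p0 F≤B #F≡#B-mod (trans (split h R≡) k≡l+l) l≤M
      ...   | inj₁ F≡B = F≡B
      ...   | inj₂ (refl , F0 , sum) = ⊥-elim (around-twice R≡ (inj₂ F0) (trans (sym (split 0 R≡)) sum))
      closing-even l k≡l+l l≤M | h , R≡ | inj₂ B≤F
        with even-closure h (#B k) (#F k) l p0 B≤F (sym #F≡#B-mod) (trans (split-swapped h R≡) k≡l+l) l≤M
      ...   | inj₁ B≡F = sym B≡F
      ...   | inj₂ (refl , B0 , sum) = ⊥-elim (around-twice R≡ (inj₁ B0) (trans (sym (split-swapped 0 R≡)) sum))

      closing-odd : k ≡ M → #R k ≡ 0 × (#B k ≡ 0 ⊎ #F k ≡ 0)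
      closing-odd k≡M with #R-even | ≤-total (#F k) (#B k)
      ... | h , R≡ | inj₁ F≤B with odd-closure h (#F k) (#B k) p0 F≤B #F≡#B-mod (trans (split h R≡) k≡M)
      ...   | refl , F0 = R≡ , inj₂ F0
      closing-odd k≡M | h , R≡ | inj₂ B≤F with odd-closure h (#B k) (#F k) p0 B≤F (sym #F≡#B-mod) (trans (split-swapped h R≡) k≡M)
      ...   | refl , B0 = R≡ , inj₁ B0

      -- The height #F − #B at time t is at most the height at time T (stated without subtraction).
      _≼_ : ℕ → ℕ → Set
      t ≼ T = #F t + #B T ≤ #F T + #B t

      ≼-trans : ∀ t T T' → t ≼ T → T ≼ T' → t ≼ T'
      ≼-trans t T T' t≼T T≼T' = +-cancelʳ-≤ (#F T + #B T) _ _ (subst₂ _≤_ (shuffle₁ (#F t) (#B T') (#F T) (#B T))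
        (shuffle₂ (#F T') (#B t) (#F T) (#B T)) (+-mono-≤ {#F t + #B T} t≼T T≼T'))
        where
          shuffle₁ : ∀ a b c d → a + d + (c + b) ≡ a + b + (c + d)
          shuffle₁ = solve-∀
          shuffle₂ : ∀ a b c d → c + b + (a + d) ≡ a + b + (c + d)
          shuffle₂ = solve-∀

      highest-upto : ∀ N → ∃ λ T → T ≤ N × (∀ t → t ≤ N → t ≼ T)
      highest-upto zero = 0 , z≤n , λ { .0 z≤n → ≤-refl }
      highest-upto (suc N) with highest-upto N
      ... | T , T≤N , top with suc N ≼? T
        where
          _≼?_ : ∀ t T → Dec (t ≼ T)
          t ≼? T = #F t + #B T ≤? #F T + #B t
      ...   | yes N+1≼T = T , m≤n⇒m≤1+n T≤N , λ t t≤1+N →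
                [ (λ t<1+N → top t (s≤s⁻¹ t<1+N)) , (λ { refl → N+1≼T }) ] (m≤n⇒m<n∨m≡n t≤1+N)
      ...   | no N+1⋠T = suc N , ≤-refl , λ t t≤1+N →
                [ (λ t<1+N → ≼-trans t T (suc N) (top t (s≤s⁻¹ t<1+N)) (<⇒≤ (≰⇒> N+1⋠T)))
                , (λ { refl → ≤-refl }) ] (m≤n⇒m<n∨m≡n t≤1+N)

      -- A record rather than a function, so that `with` on a later move leaves it alone.
      record Peak (T : ℕ) : Set where
        constructor peak-at
        field below : ∀ t → t ≼ T
      open Peak

      not-forward-at-peak : ∀ T → Peak T → move T ≢ forward
      not-forward-at-peak T peak e = 1+n≰n (subst₂ _≤_ (cong (_+ #B T) F↑) (cong (#F T +_) B=) (below peak (suc T)))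
        where
          F↑ : #F (suc T) ≡ suc (#F T)
          F↑ = cong (λ σ → hits σ forward + #F T) e
          B= : #B (suc T) ≡ #B T
          B= = cong (λ σ → hits σ backward + #B T) e

      not-backward-before-peak : ∀ T → Peak (suc T) → move T ≢ backward
      not-backward-before-peak T peak e = 1+n≰n (subst₂ _≤_ (trans (cong (#F T +_) B↑) (+-suc (#F T) (#B T))) (cong (_+ #B T) F=) (below peak T))
        where
          F= : #F (suc T) ≡ #F T
          F= = cong (λ σ → hits σ forward + #F T) e
          B↑ : #B (suc T) ≡ suc (#B T)
          B↑ = cong (λ σ → hits σ backward + #B T) e

      across-keeps-height : ∀ T → move T ≡ across → #F (suc T) ≡ #F T × #B (suc T) ≡ #B T
      across-keeps-height T e = cong (λ σ → hits σ forward + #F T) e , cong (λ σ → hits σ backward + #B T) e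

      peak-after-across : ∀ T → Peak T → move T ≡ across → Peak (suc T)
      peak-after-across T peak e = peak-at λ t → subst₂ _≤_ (cong (#F t +_) (sym (proj₂ (across-keeps-height T e))))
        (cong (_+ #B t) (sym (proj₁ (across-keeps-height T e)))) (below peak t)

      peak-before-across : ∀ T → Peak (suc T) → move T ≡ across → Peak T
      peak-before-across T peak e = peak-at λ t → subst₂ _≤_ (cong (#F t +_) (proj₂ (across-keeps-height T e)))
        (cong (_+ #B t) (proj₁ (across-keeps-height T e))) (below peak t)

      -- Once #F k ≡ #B k the height is k-periodic, so a maximum over one period is a global one.
      module Balanced (F≡B : #F k ≡ #B k) where

        ≼-+k : ∀ {t T} → t ≼ T → (t + k) ≼ T
        ≼-+k {t} {T} t≼T = subst₂ _≤_ (cong (_+ #B T) (sym (trans (count-period forward t) (cong (#F t +_) F≡B))))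
          (cong (#F T +_) (sym (count-period backward t))) (shift (#F t) (#B T) (#B k) (#F T) (#B t) t≼T)
          where
            shift : ∀ a b c d e → a + b ≤ d + e → (a + c) + b ≤ d + (e + c)
            shift a b c d e le = subst₂ _≤_ (rearrange₁ a b c) (+-assoc d e c) (+-monoˡ-≤ c le)
              where
                rearrange₁ : ∀ a b c → a + b + c ≡ a + c + b
                rearrange₁ = solve-∀

        ≼-+k* : ∀ c {t T} → t ≼ T → (t + c * k) ≼ T
        ≼-+k* zero    {t} {T} t≼T = subst (_≼ T) (sym (+-identityʳ t)) t≼T
        ≼-+k* (suc c) {t} {T} t≼T = subst (_≼ T) (reassoc t (c * k)) (≼-+k {t + c * k} {T} (≼-+k* c {t} {T} t≼T))
          where
            reassoc : ∀ a b → a + b + k ≡ a + (k + b)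
            reassoc a b = trans (+-assoc a b k) (cong (a +_) (+-comm b k))

        ≼-k+ : ∀ {t T} → t ≼ T → t ≼ (T + k)
        ≼-k+ {t} {T} t≼T = subst₂ _≤_ (cong (#F t +_) (sym (count-period backward T)))
          (cong (_+ #B t) (sym (trans (count-period forward T) (cong (#F T +_) F≡B)))) (shift (#F t) (#B T) (#B k) (#F T) (#B t) t≼T)
          where
            shift : ∀ a b c d e → a + b ≤ d + e → a + (b + c) ≤ (d + c) + e
            shift a b c d e le = subst₂ _≤_ (+-assoc a b c) (rearrange₂ d e c) (+-monoˡ-≤ c le)
              where
                rearrange₂ : ∀ d e c → d + e + c ≡ d + c + e
                rearrange₂ = solve-∀

        T₀ : ℕ
        T₀ = proj₁ (highest-upto k')

        peak : Peak (T₀ + k)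
        peak = peak-at λ t → ≼-k+ {t} {T₀}
          (subst (_≼ T₀) (sym (m≡m%n+[m/n]*n t k)) (≼-+k* (t / k) {t % k} {T₀} (highest (t % k) (s≤s⁻¹ (m%n<n t k)))))
          where
            highest : ∀ t → t ≤ k' → t ≼ T₀
            highest = proj₂ (proj₂ (highest-upto k'))

        -- After a peak the walk cannot go forward, before it not backward, and it never reverses a step.
        fold-at-peak : ∀ T → Peak (suc (suc T)) →
                      ∃ λ Y → move Y ≡ forward × move (suc Y) ≡ across × move (suc (suc Y)) ≡ backward
        fold-at-peak T peakP with move (suc (suc T)) in eP
        ... | forward = ⊥-elim (not-forward-at-peak (suc (suc T)) peakP eP)
        ... | across with move (suc (suc (suc T))) in eP+1 | move (suc T) in eP-1
        ...   | forward  | _        = ⊥-elim (not-forward-at-peak (suc (suc (suc T))) (peak-after-across (suc (suc T)) peakP eP) eP+1)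
        ...   | across   | _        = ⊥-elim (no-across-across (suc (suc T)) eP eP+1)
        ...   | backward | backward = ⊥-elim (not-backward-before-peak (suc T) peakP eP-1)
        ...   | backward | across   = ⊥-elim (no-across-across (suc T) eP-1 eP)
        ...   | backward | forward  = suc T , eP-1 , eP , eP+1
        fold-at-peak T peakP | backward with move (suc T) in eP-1
        ...   | backward = ⊥-elim (not-backward-before-peak (suc T) peakP eP-1)
        ...   | forward  = ⊥-elim (no-forward-backward (suc T) eP-1 eP)
        ...   | across with move T in eP-2
        ...     | backward = ⊥-elim (not-backward-before-peak T (peak-before-across (suc T) peakP eP-1) eP-2)
        ...     | across   = ⊥-elim (no-across-across T eP-2 eP-1)
        ...     | forward  = T , eP-2 , eP-1 , eP

        fold : ∃ λ Y → move Y ≡ forward × move (suc Y) ≡ across × move (suc (suc Y)) ≡ backward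
        fold = fold-at-peak (T₀ + k ∸ 2) (subst Peak (sym (m+[n∸m]≡n 2≤T₀+k)) peak)
          where
            2≤T₀+k : 2 ≤ T₀ + k
            2≤T₀+k = ≤-trans (≤-trans (n≤1+n 2) 3≤k) (m≤n+m k T₀)

      -- From the rung at time 0 the walk runs backward along one layer and, read back from time k,
      -- forward along the other; both runs end in a rung, and injectivity makes them equally long.
      module Rectangle (m0 : move 0 ≡ across) (m1 : move 1 ≡ backward) (m-1 : move k' ≡ forward) where

        private
          q : ℕ
          q = proj₁ (m≤n⇒∃[o]m+o≡n 3≤k)

          k'≡2+q : k' ≡ suc (suc q)
          k'≡2+q = sym (suc-injective (proj₂ (m≤n⇒∃[o]m+o≡n 3≤k)))

          ≢0⇒suc : ∀ {a} → a ≢ 0 → ∃ λ a' → a ≡ suc a'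
          ≢0⇒suc {zero}  a≢0 = ⊥-elim (a≢0 refl)
          ≢0⇒suc {suc a} _   = a , refl

        up-run : ∃ λ u → u ≤ suc q × move (suc u) ≢ backward × (∀ u' → u' < u → ¬ move (suc u') ≢ backward)
        up-run = least-witness (λ u → move (suc u) ≢ backward) (λ u → ¬? (move (suc u) ≟ᵐ backward)) (suc q)
                   (λ e → forward≢backward (trans (sym (subst (λ x → move x ≡ forward) k'≡2+q m-1)) e))
          where
            forward≢backward : forward ≢ backward
            forward≢backward ()

        a : ℕ
        a = proj₁ up-run

        up-backward : ∀ u → u < a → move (suc u) ≡ backward
        up-backward u u<a = decidable-stable (move (suc u) ≟ᵐ backward) (proj₂ (proj₂ (proj₂ up-run)) u u<a)

        a≢0 : a ≢ 0
        a≢0 e = proj₁ (proj₂ (proj₂ up-run)) (subst (λ x → move (suc x) ≡ backward) (sym e) m1)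

        up-turn : move (suc a) ≡ across
        up-turn = turn (move (suc a)) refl
          where
            turn : ∀ σ → move (suc a) ≡ σ → move (suc a) ≡ across
            turn across   e = e
            turn backward e = ⊥-elim (proj₁ (proj₂ (proj₂ up-run)) e)
            turn forward  e = ⊥-elim (no-backward-forward a
              (subst (λ x → move x ≡ backward) (sym a≡) (up-backward a' (subst (a' <_) (sym a≡) ≤-refl))) e)
              where
                a' : ℕ
                a' = proj₁ (≢0⇒suc a≢0)
                a≡ : a ≡ suc a'
                a≡ = proj₂ (≢0⇒suc a≢0)

        2+a≤k' : suc (suc a) ≤ k'
        2+a≤k' = [ id , (λ e → ⊥-elim (across≢forward (trans (sym up-turn) (trans (cong move e) m-1)))) ]′
                   (m≤n⇒m<n∨m≡n (subst (suc a ≤_) (sym k'≡2+q) (s≤s (proj₁ (proj₂ up-run)))))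
          where
            across≢forward : across ≢ forward
            across≢forward ()

        up : ∀ u → u ≤ a → W (suc u) ≡ (other s0 , prev^ u p0)
        up zero    _   = moves-as 0 m0
        up (suc u) u<a = advance≡⇒ (trans (sym (moves-as (suc u) (up-backward u u<a))) (up u (≤-trans (n≤1+n u) u<a)))

        after-up : W (suc (suc a)) ≡ (s0 , prev^ a p0)
        after-up = trans (moves-as (suc a) up-turn) (trans (cong cross (up a ≤-refl)) (cong (_, prev^ a p0) (other-involutive s0)))

        down-run : ∃ λ v → v ≤ suc q × move (k' ∸ v) ≢ forward × (∀ v' → v' < v → ¬ move (k' ∸ v') ≢ forward)
        down-run = least-witness (λ v → move (k' ∸ v) ≢ forward) (λ v → ¬? (move (k' ∸ v) ≟ᵐ forward)) (suc q)
                     (λ e → backward≢forward (trans (sym (subst (λ x → move x ≡ backward) (sym k'∸[1+q]≡1) m1)) e))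
          where
            backward≢forward : backward ≢ forward
            backward≢forward ()
            k'∸[1+q]≡1 : k' ∸ suc q ≡ 1
            k'∸[1+q]≡1 = trans (cong (_∸ suc q) k'≡2+q) (m+n∸n≡m 1 (suc q))

        b : ℕ
        b = proj₁ down-run

        down-forward : ∀ v → v < b → move (k' ∸ v) ≡ forward
        down-forward v v<b = decidable-stable (move (k' ∸ v) ≟ᵐ forward) (proj₂ (proj₂ (proj₂ down-run)) v v<b)

        b<k' : b < k'
        b<k' = subst (b <_) (sym k'≡2+q) (s≤s (proj₁ (proj₂ down-run)))

        k∸v≡1+k'∸v : ∀ v → v ≤ k' → k ∸ v ≡ suc (k' ∸ v)
        k∸v≡1+k'∸v v v≤k' = +-∸-assoc 1 v≤k'

        down-turn : move (k' ∸ b) ≡ across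
        down-turn = turn (move (k' ∸ b)) refl
          where
            turn : ∀ σ → move (k' ∸ b) ≡ σ → move (k' ∸ b) ≡ across
            turn across   e = e
            turn forward  e = ⊥-elim (proj₁ (proj₂ (proj₂ down-run)) e)
            turn backward e = ⊥-elim (no-backward-forward (k' ∸ b) e
              (trans (cong move (trans (cong (λ x → suc (k' ∸ x)) b≡) (sym (+-∸-assoc 1 (subst (_≤ k') b≡ (<⇒≤ b<k'))))))
                     (down-forward b' (subst (b' <_) (sym b≡) ≤-refl))))
              where
                b≢0 : b ≢ 0
                b≢0 b≡0 = proj₁ (proj₂ (proj₂ down-run)) (subst (λ x → move (k' ∸ x) ≡ forward) (sym b≡0) m-1)
                b' : ℕ
                b' = proj₁ (≢0⇒suc b≢0)
                b≡ : b ≡ suc b'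
                b≡ = proj₂ (≢0⇒suc b≢0)

        down : ∀ v → v ≤ b → W (k ∸ v) ≡ (s0 , prev^ v p0)
        down zero    _   = W-k
        down (suc v) v<b = advance≡⇒ (trans (sym (moves-as (k' ∸ v) (down-forward v v<b)))
                             (trans (cong W (sym (k∸v≡1+k'∸v v (≤-trans (n≤1+n v) (≤-trans v<b (<⇒≤ b<k'))))))
                                    (down v (≤-trans (n≤1+n v) v<b))))

        before-down : W (k' ∸ b) ≡ (other s0 , prev^ b p0)
        before-down = trans (sym (cross-involutive (W (k' ∸ b))))
          (cong cross (trans (sym (moves-as (k' ∸ b) down-turn)) (trans (cong W (sym (k∸v≡1+k'∸v b (<⇒≤ b<k')))) (down b ≤-refl))))

        rectangle-shape : ∃ λ a → RectangleWalk W k a s0 p0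
        rectangle-shape = [ meet-at-a , (λ a≰b → ⊥-elim (no-meet-at-b (≰⇒> a≰b))) ]′ (toSum (a ≤? b))
          where
            meet-at-a : a ≤ b → ∃ λ a → RectangleWalk W k a s0 p0
            meet-at-a a≤b = a , record
              { length≡ = k≡2+a+a ; start = refl ; up = up ; down = λ v v≤a → down v (≤-trans v≤a a≤b) }
              where
                2+a<k : suc (suc a) < k
                2+a<k = s≤s 2+a≤k'
                a≤k : a ≤ k
                a≤k = ≤-trans (n≤1+n a) (≤-trans (n≤1+n (suc a)) (<⇒≤ 2+a<k))
                2+a≡k∸a : suc (suc a) ≡ k ∸ a
                2+a≡k∸a = W-injective 2+a<k (∸-monoʳ-< {k} {a} {0} (n≢0⇒n>0 a≢0) a≤k) (trans after-up (sym (down a a≤b)))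
                k≡2+a+a : k ≡ suc (suc (a + a))
                k≡2+a+a = trans (sym (m∸n+n≡m a≤k)) (cong (_+ a) (sym 2+a≡k∸a))
            no-meet-at-b : b < a → ⊥
            no-meet-at-b b<a = across≢backward (trans (sym down-turn) (trans (cong move meet) (up-backward b b<a)))
              where
                across≢backward : across ≢ backward
                across≢backward ()
                meet : k' ∸ b ≡ suc b
                meet = W-injective (s≤s (m∸n≤m k' b)) (s≤s (≤-trans b<a (≤-trans (n≤1+n a) (<⇒≤ 2+a≤k'))))
                         (trans before-down (sym (up b (<⇒≤ b<a))))

    move-rotated : ∀ j0 s t → From.move (C.next^ s j0) t ≡ From.move j0 (t + s)
    move-rotated j0 s t = cong moveAt (sym (C.next^-+ t s j0))

  -- Edges traced by rectangles and layers

  Traces : (ℕ → Vertex) → ℕ → Edge → Set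
  Traces W k e = ∃ λ t → t < k × Joins e (W t) (W (suc t))

  joins-cong : ∀ {e : Edge} {x x' y y' : Vertex} {Q : Set} → x ≡ x' → y ≡ y' → (Joins e x' y' ⇔ Q) → (Joins e x y ⇔ Q)
  joins-cong refl refl h = h

  -- The rim edge (rim s , i) joins i and next i, so the sides are indexed by prev^ 1 P, …, prev^ a P.
  RectangleEdge : ℕ → Fin M → Edge → Set
  RectangleEdge a P e = e ≡ (rung , P) ⊎ e ≡ (rung , prev^ a P)
                      ⊎ ∃ λ (d : Fin a) → ∃ λ s → e ≡ (rim s , prev^ (suc (toℕ d)) P)

  module RectangleEdges {W : ℕ → Vertex} {k a : ℕ} {s : Fin 2} {P : Fin M} (rect : RectangleWalk W k a s P) where

    open RectangleWalk rect

    k∸a≡2+a : k ∸ a ≡ suc (suc a)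
    k∸a≡2+a = trans (cong (_∸ a) length≡) (m+n∸n≡m (suc (suc a)) a)

    a<k : a < k
    a<k = subst (a <_) (sym length≡) (s≤s (≤-trans (m≤m+n a a) (n≤1+n _)))

    first-rung : ∀ e → Joins e (W 0) (W 1) ⇔ (e ≡ (rung , P))
    first-rung e = joins-cong start (up 0 z≤n) (joins-across s P e)

    up-edge : ∀ u → u < a → ∀ e → Joins e (W (suc u)) (W (suc (suc u))) ⇔ (e ≡ (rim (other s) , prev^ (suc u) P))
    up-edge u u<a e = joins-cong (trans (up u (<⇒≤ u<a)) (cong (other s ,_) (sym (next-prev (prev^ u P))))) (up (suc u) u<a)
                        (joins-backward (other s) (prev^ (suc u) P) e)

    second-rung : ∀ e → Joins e (W (suc a)) (W (suc (suc a))) ⇔ (e ≡ (rung , prev^ a P))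
    second-rung e = joins-cong (up a ≤-refl)
                      (trans (cong W (sym k∸a≡2+a)) (trans (down a ≤-refl) (cong (_, prev^ a P) (sym (other-involutive s)))))
                      (joins-across (other s) (prev^ a P) e)

    down-edge : ∀ v → v < a → ∀ e → Joins e (W (k ∸ suc v)) (W (suc (k ∸ suc v))) ⇔ (e ≡ (rim s , prev^ (suc v) P))
    down-edge v v<a e = joins-cong (down (suc v) v<a)
                          (trans (cong W (sym (+-∸-assoc 1 (<-trans v<a a<k)))) (trans (down v (<⇒≤ v<a)) (cong (s ,_) (sym (next-prev (prev^ v P))))))
                          (joins-forward s (prev^ (suc v) P) e)

    stretch : ∀ t → t < k → t ≡ 0 ⊎ (∃ λ u → u < a × t ≡ suc u) ⊎ t ≡ suc a ⊎ (∃ λ v → v < a × t ≡ k ∸ suc v)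
    stretch zero    t<k = inj₁ refl
    stretch (suc u) t<k with <-cmp u a
    ... | tri< u<a _ _ = inj₂ (inj₁ (u , u<a , refl))
    ... | tri≈ _ u≡a _ = inj₂ (inj₂ (inj₁ (cong suc u≡a)))
    ... | tri> _ _ a<u = inj₂ (inj₂ (inj₂ (a ∸ suc x , a∸[1+x]<a , sym k∸[a∸x]≡1+u)))
      where
        x : ℕ
        x = u ∸ suc a
        u≡x+1+a : u ≡ x + suc a
        u≡x+1+a = sym (m∸n+n≡m a<u)
        1+x≤a : suc x ≤ a
        1+x≤a = +-cancelʳ-≤ a (suc x) a (s≤s⁻¹ (s≤s⁻¹
                  (subst (_< suc (suc (a + a))) (cong suc (trans u≡x+1+a (+-suc x a))) (subst (suc u <_) length≡ t<k))))
        a≡1+x+y : a ≡ suc x + (a ∸ suc x)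
        a≡1+x+y = sym (m+[n∸m]≡n 1+x≤a)
        a∸[1+x]<a : a ∸ suc x < a
        a∸[1+x]<a = subst (a ∸ suc x <_) (sym a≡1+x+y) (s≤s (m≤n+m (a ∸ suc x) x))
        unfold : ∀ x y → suc (suc ((suc x + y) + (suc x + y))) ≡ suc (x + suc (suc x + y)) + suc y
        unfold = solve-∀
        k∸[a∸x]≡1+u : k ∸ suc (a ∸ suc x) ≡ suc u
        k∸[a∸x]≡1+u = let y = a ∸ suc x in
          trans (cong (_∸ suc y) (trans length≡ (cong (λ z → suc (suc (z + z))) a≡1+x+y)))
                (trans (cong (_∸ suc y) (unfold x y)) (trans (m+n∸n≡m _ (suc y))
                       (cong suc (sym (trans u≡x+1+a (cong (λ z → x + suc z) a≡1+x+y))))))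

    edges : ∀ e → Traces W k e ⇔ RectangleEdge a P e
    edges e = mk⇔ to from
      where
        to : Traces W k e → RectangleEdge a P e
        to (t , t<k , J) with stretch t t<k
        ... | inj₁ refl = inj₁ (Equivalence.to (first-rung e) J)
        ... | inj₂ (inj₁ (u , u<a , refl)) = inj₂ (inj₂ (fromℕ< u<a , other s ,
                trans (Equivalence.to (up-edge u u<a e) J) (cong (λ z → rim (other s) , prev^ (suc z) P) (sym (toℕ-fromℕ< u<a)))))
        ... | inj₂ (inj₂ (inj₁ refl)) = inj₂ (inj₁ (Equivalence.to (second-rung e) J))
        ... | inj₂ (inj₂ (inj₂ (v , v<a , refl))) = inj₂ (inj₂ (fromℕ< v<a , s ,
                trans (Equivalence.to (down-edge v v<a e) J) (cong (λ z → rim s , prev^ (suc z) P) (sym (toℕ-fromℕ< v<a)))))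
        from : RectangleEdge a P e → Traces W k e
        from (inj₁ eq) = 0 , subst (0 <_) (sym length≡) (s≤s z≤n) , Equivalence.from (first-rung e) eq
        from (inj₂ (inj₁ eq)) = suc a , subst (suc a <_) (sym length≡) (s≤s (s≤s (m≤m+n a a))) , Equivalence.from (second-rung e) eq
        from (inj₂ (inj₂ (d , s' , eq))) with layer-cases s' s
        ... | inj₁ refl = k ∸ suc (toℕ d) , ∸-monoʳ-< {k} {suc (toℕ d)} {0} (s≤s z≤n) (<-trans (toℕ<n d) a<k)
                        , Equivalence.from (down-edge (toℕ d) (toℕ<n d) e) eq
        ... | inj₂ refl = suc (toℕ d) , ≤-trans (s≤s (toℕ<n d)) a<k , Equivalence.from (up-edge (toℕ d) (toℕ<n d) e) eq

    adjacent : ∀ t → t < k → Adjacent (W t) (W (suc t))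
    adjacent t t<k with stretch t t<k
    ... | inj₁ refl = (rung , P) , Equivalence.from (first-rung _) refl
    ... | inj₂ (inj₁ (u , u<a , refl)) = (rim (other s) , prev^ (suc u) P) , Equivalence.from (up-edge u u<a _) refl
    ... | inj₂ (inj₂ (inj₁ refl)) = (rung , prev^ a P) , Equivalence.from (second-rung _) refl
    ... | inj₂ (inj₂ (inj₂ (v , v<a , refl))) = (rim s , prev^ (suc v) P) , Equivalence.from (down-edge v v<a _) refl

  module ForwardLayerEdges {W : ℕ → Vertex} {s : Fin 2} {p0 : Fin M} (along : ∀ t → t ≤ M → W t ≡ (s , next^ t p0)) where

    step : ∀ t → t < M → ∀ e → Joins e (W t) (W (suc t)) ⇔ (e ≡ (rim s , next^ t p0))
    step t t<M e = joins-cong (along t (<⇒≤ t<M)) (along (suc t) t<M) (joins-forward s (next^ t p0) e)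

    edges : ∀ e → Traces W M e ⇔ (proj₁ e ≡ rim s)
    edges e = mk⇔ (λ { (t , t<M , J) → cong proj₁ (Equivalence.to (step t t<M e) J) }) from
      where
        from : proj₁ e ≡ rim s → Traces W M e
        from e₁≡ with next^-surjective p0 (proj₂ e)
        ... | t , t<M , eq = t , t<M , Equivalence.from (step t t<M e) (cong₂ _,_ e₁≡ (sym eq))

  module BackwardLayerEdges {W : ℕ → Vertex} {s : Fin 2} {p0 : Fin M} (along : ∀ t → t ≤ M → W t ≡ (s , prev^ t p0)) where

    step : ∀ t → t < M → ∀ e → Joins e (W t) (W (suc t)) ⇔ (e ≡ (rim s , prev^ (suc t) p0))
    step t t<M e = joins-cong (trans (along t (<⇒≤ t<M)) (cong (s ,_) (sym (next-prev (prev^ t p0))))) (along (suc t) t<M)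
                     (joins-backward s (prev^ (suc t) p0) e)

    edges : ∀ e → Traces W M e ⇔ (proj₁ e ≡ rim s)
    edges e = mk⇔ (λ { (t , t<M , J) → cong proj₁ (Equivalence.to (step t t<M e) J) }) from
      where
        from : proj₁ e ≡ rim s → Traces W M e
        from e₁≡ with next^-surjective (proj₂ e) p0
        ... | suc t , t<M , eq = t , <-trans (n<1+n t) t<M , Equivalence.from (step t (<-trans (n<1+n t) t<M) e)
                                   (cong₂ _,_ e₁≡ (sym (trans (cong (prev^ (suc t)) (sym eq)) (prev^-next^ (suc t) (proj₂ e)))))
        ... | zero , _ , eq = 2 * n , ≤-refl , Equivalence.from (step (2 * n) ≤-refl e) (cong₂ _,_ e₁≡ (trans eq (sym (prev^-K p0))))

  rectangle-edge? : ∀ a P e → Dec (RectangleEdge a P e)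
  rectangle-edge? a P e = (e ≟ᵉ (rung , P)) ⊎-dec ((e ≟ᵉ (rung , prev^ a P))
                          ⊎-dec any? (λ d → any? (λ s → e ≟ᵉ (rim s , prev^ (suc (toℕ d)) P))))
    where
      _≟ᵉ_ : (e e' : Edge) → Dec (e ≡ e')
      _≟ᵉ_ = ≡-dec _≟ᶠ_ _≟ᶠ_

  rectangleCycle : ℕ → Fin M → EdgeSet M
  rectangleCycle a P = edgeSetOf (RectangleEdge a P) (rectangle-edge? a P)

  ∈-rectangleCycle : ∀ a P e → (e ∈E rectangleCycle a P) ⇔ RectangleEdge a P e
  ∈-rectangleCycle a P = ∈E-edgeSetOf (RectangleEdge a P) (rectangle-edge? a P)

  LayerEdge : Fin 2 → Edge → Set
  LayerEdge s e = proj₁ e ≡ rim s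

  layerCycle : Fin 2 → EdgeSet M
  layerCycle s = edgeSetOf (LayerEdge s) (λ e → proj₁ e ≟ᶠ rim s)

  ∈-layerCycle : ∀ s e → (e ∈E layerCycle s) ⇔ LayerEdge s e
  ∈-layerCycle s = ∈E-edgeSetOf (LayerEdge s) (λ e → proj₁ e ≟ᶠ rim s)

  rectangleCycle-injective : ∀ a {P P'} → suc a < M → rectangleCycle (suc a) P ≡ rectangleCycle (suc a) P' → P ≡ P'
  rectangleCycle-injective a {P} {P'} 1+a<M eq = pinned λ e →
    ⇔.trans (⇔.sym (∈-rectangleCycle (suc a) P e))
            (subst (λ S → (e ∈E S) ⇔ RectangleEdge (suc a) P' e) (sym eq) (∈-rectangleCycle (suc a) P' e))
    where
      pinned : (∀ e → RectangleEdge (suc a) P e ⇔ RectangleEdge (suc a) P' e) → P ≡ P'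
      pinned same with Equivalence.to (same (rung , P)) (inj₁ refl)
      ... | inj₁ e = cong proj₂ e
      ... | inj₂ (inj₂ (_ , s , e)) = ⊥-elim (rim≢rung s (sym (cong proj₁ e)))
      ... | inj₂ (inj₁ e) with Equivalence.from (same (rim fzero , P))
             (inj₂ (inj₂ (fromℕ< (n<1+n a) , fzero , cong (rim fzero ,_)
               (trans (cong proj₂ e) (cong (λ z → prev^ (suc z) P') (sym (toℕ-fromℕ< (n<1+n a))))))))
      ...   | inj₁ e' = ⊥-elim (rim≢rung fzero (cong proj₁ e'))
      ...   | inj₂ (inj₁ e') = ⊥-elim (rim≢rung fzero (cong proj₁ e'))
      ...   | inj₂ (inj₂ (d , _ , e')) = ⊥-elim (0≢1+n (prev^-injective P (s≤s z≤n) (≤-trans (s≤s (toℕ<n d)) 1+a<M) (cong proj₂ e')))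

  layerCycle-isCycle : ∀ s → IsCycle M M (layerCycle s)
  layerCycle-isCycle s = (s ,_) , 2<M , cong proj₂ , (λ j → (rim s , j) , Equivalence.from (joins-forward s j _) refl) , λ e → begin
      e ∈E layerCycle s                                 ≈⟨ ∈-layerCycle s e ⟩
      LayerEdge s e                                     ≈⟨ ForwardLayerEdges.edges {p0 = fzero} (λ t _ → refl) e ⟨
      Traces (λ t → s , next^ t fzero) M e              ≈⟨ ∃-next⇔∃-next^ (s ,_) (Joins e) fzero ⟨
      (∃ λ j → Joins e (s , j) (s , next j))            ∎
    where open ⇔-Reasoning

  module RectangleCycle (a : ℕ) (1≤a : 1 ≤ a) (a<M : a < M) (P : Fin M) where

    K' : ℕ
    K' = a + suc (a + 0)

    k : ℕ
    k = suc K'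

    module R = Rotation K'

    k≡2+a+a : k ≡ suc (suc (a + a))
    k≡2+a+a = cong suc (trans (cong (a +_) (cong suc (+-identityʳ a))) (+-suc a a))

    upper : ℕ → Vertex
    upper zero    = fzero , P
    upper (suc u) = fsuc fzero , prev^ u P

    corner : ℕ → Vertex
    corner t with t ≤? suc a
    ... | yes _ = upper t
    ... | no _  = fzero , prev^ (k ∸ t) P

    corner-low : ∀ {t} → t ≤ suc a → corner t ≡ upper t
    corner-low {t} t≤1+a with t ≤? suc a
    ... | yes _ = refl
    ... | no t≰1+a = ⊥-elim (t≰1+a t≤1+a)

    corner-high : ∀ {t} → ¬ (t ≤ suc a) → corner t ≡ (fzero , prev^ (k ∸ t) P)
    corner-high {t} t≰1+a with t ≤? suc a
    ... | yes t≤1+a = ⊥-elim (t≰1+a t≤1+a)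
    ... | no _ = refl

    w : Fin k → Vertex
    w j = corner (toℕ j)

    W : ℕ → Vertex
    W t = w (R.next^ t fzero)

    W≡corner : ∀ t → t < k → W t ≡ corner t
    W≡corner t t<k = cong corner (trans (R.toℕ-next^ t fzero) (m<n⇒m%n≡m t<k))

    1+u<k : ∀ {u} → u ≤ a → suc u < k
    1+u<k {u} u≤a = subst (suc u <_) (sym k≡2+a+a) (s≤s (s≤s (≤-trans u≤a (m≤m+n a a))))

    rectangleWalk : RectangleWalk W k a fzero P
    rectangleWalk = record { length≡ = k≡2+a+a ; start = corner-low z≤n ; up = up ; down = down }
      where
        up : ∀ u → u ≤ a → W (suc u) ≡ (other fzero , prev^ u P)
        up u u≤a = trans (W≡corner (suc u) (1+u<k u≤a)) (corner-low (s≤s u≤a))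
        down : ∀ v → v ≤ a → W (k ∸ v) ≡ (fzero , prev^ v P)
        down zero    _   = trans (cong w (R.next^-K fzero)) (corner-low z≤n)
        down (suc v) v<a = trans (W≡corner (k ∸ suc v) (∸-monoʳ-< {k} {suc v} {0} (s≤s z≤n) 1+v≤k))
                             (trans (corner-high (<⇒≱ far)) (cong (λ z → fzero , prev^ z P) (m∸[m∸n]≡n 1+v≤k)))
          where
            1+v≤k : suc v ≤ k
            1+v≤k = ≤-trans (n≤1+n _) (<⇒≤ (1+u<k v<a))
            far : suc a < k ∸ suc v
            far = subst (_≤ k ∸ suc v) (trans (cong (_∸ a) k≡2+a+a) (m+n∸n≡m (suc (suc a)) a)) (∸-monoʳ-≤ k v<a)

    k∸t<M : ∀ {t} → ¬ (t ≤ suc a) → k ∸ t < M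
    k∸t<M {t} t≰1+a = ≤-<-trans (subst (k ∸ t ≤_) k∸[2+a]≡a (∸-monoʳ-≤ k (≰⇒> t≰1+a))) a<M
      where
        k∸[2+a]≡a : k ∸ suc (suc a) ≡ a
        k∸[2+a]≡a = trans (cong (_∸ suc (suc a)) k≡2+a+a) (m+n∸m≡n a a)

    upper-injective : ∀ t t' → t ≤ suc a → t' ≤ suc a → upper t ≡ upper t' → t ≡ t'
    upper-injective zero    zero     _         _          e = refl
    upper-injective zero    (suc u') _         _          ()
    upper-injective (suc u) zero     _         _          ()
    upper-injective (suc u) (suc u') (s≤s u≤a) (s≤s u'≤a) e =
      cong suc (prev^-injective P (≤-<-trans u≤a a<M) (≤-<-trans u'≤a a<M) (cong proj₂ e))

    upper≢lower : ∀ t t' → t ≤ suc a → ¬ (t' ≤ suc a) → t' < k → upper t ≢ (fzero , prev^ (k ∸ t') P)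
    upper≢lower zero    t' _ t'≰1+a t'<k e = <⇒≢ (m<n⇒0<n∸m t'<k) (prev^-injective P (s≤s z≤n) (k∸t<M t'≰1+a) (cong proj₂ e))
    upper≢lower (suc u) t' _ _ _ ()

    corner-injective : ∀ {t t'} → t < k → t' < k → corner t ≡ corner t' → t ≡ t'
    corner-injective {t} {t'} t<k t'<k e with toSum (t ≤? suc a) | toSum (t' ≤? suc a)
    ... | inj₁ t≤ | inj₁ t'≤ = upper-injective t t' t≤ t'≤ (trans (sym (corner-low t≤)) (trans e (corner-low t'≤)))
    ... | inj₁ t≤ | inj₂ t'≰ = ⊥-elim (upper≢lower t t' t≤ t'≰ t'<k (trans (sym (corner-low t≤)) (trans e (corner-high t'≰))))
    ... | inj₂ t≰  | inj₁ t'≤ = ⊥-elim (upper≢lower t' t t'≤ t≰ t<k (sym (trans (sym (corner-high t≰)) (trans e (corner-low t'≤)))))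
    ... | inj₂ t≰  | inj₂ t'≰ = trans (sym (m∸[m∸n]≡n (<⇒≤ t<k))) (trans (cong (k ∸_) k∸t≡k∸t') (m∸[m∸n]≡n (<⇒≤ t'<k)))
      where
        k∸t≡k∸t' : k ∸ t ≡ k ∸ t'
        k∸t≡k∸t' = prev^-injective P (k∸t<M t≰) (k∸t<M t'≰) (cong proj₂ (trans (sym (corner-high t≰)) (trans e (corner-high t'≰))))

    module Edges = RectangleEdges {W} {k} {a} {fzero} {P} rectangleWalk

    isCycle : IsCycle M k (rectangleCycle a P)
    isCycle = w , subst (3 ≤_) (sym k≡2+a+a) (s≤s (s≤s (≤-trans 1≤a (m≤m+n a a))))
            , (λ {j} {j'} e → toℕ-injective (corner-injective (toℕ<n j) (toℕ<n j') e))
            , adjacent , λ e → begin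
                e ∈E rectangleCycle a P                  ≈⟨ ∈-rectangleCycle a P e ⟩
                RectangleEdge a P e                      ≈⟨ Edges.edges e ⟨
                Traces W k e                             ≈⟨ R.∃-next⇔∃-next^ w (Joins e) fzero ⟨
                (∃ λ j → Joins e (w j) (w (next j)))     ∎
      where
        open ⇔-Reasoning
        adjacent : ∀ j → Adjacent (w j) (w (next j))
        adjacent j with R.next^-surjective fzero j
        ... | t , t<k , refl = Edges.adjacent t t<k

  cycle-is-layer : ∀ {S} → IsCycle M M S → ∃ λ s → S ≡ layerCycle s
  cycle-is-layer {S} (w , 3≤k , w-injective , adj , cycleEdges) = s0 , EdgeSet-ext S (layerCycle s0) λ e → begin
      e ∈E S                                     ≈⟨ cycleEdges e ⟩
      (∃ λ j → Joins e (w j) (w (next j)))       ≈⟨ C.∃-next⇔∃-next^ w (Joins e) fzero ⟩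
      Traces W M e                               ≈⟨ traced e ⟩
      LayerEdge s0 e                             ≈⟨ ∈-layerCycle s0 e ⟨
      e ∈E layerCycle s0                         ∎
    where
      open ⇔-Reasoning
      open ClosedWalk (2 * n) w 3≤k w-injective adj
      open From fzero
      traced : ∀ e → Traces W M e ⇔ LayerEdge s0 e
      traced with closing-odd refl
      ... | R0 , inj₁ B0 = ForwardLayerEdges.edges (forward-only R0 B0)
      ... | R0 , inj₂ F0 = BackwardLayerEdges.edges (backward-only R0 F0)

  cycle-is-rectangle : ∀ a → a < M → ∀ {S} → IsCycle M (2 * suc a) S → ∃ λ P → S ≡ rectangleCycle a P
  cycle-is-rectangle a a<M {S} (w , 3≤k , w-injective , adj , cycleEdges) = P , EdgeSet-ext S (rectangleCycle a P) same-edges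
    where
      k' : ℕ
      k' = a + suc (a + 0)
      open ClosedWalk k' w 3≤k w-injective adj
      module Start = From fzero

      k≡l+l : k ≡ suc a + suc a
      k≡l+l = cong suc (cong (a +_) (cong suc (+-identityʳ a)))

      fold : ∃ λ Y → Start.move Y ≡ forward × Start.move (suc Y) ≡ across × Start.move (suc (suc Y)) ≡ backward
      fold = Start.Balanced.fold (Start.closing-even (suc a) k≡l+l a<M)
      Y : ℕ
      Y = proj₁ fold

      j' : Fin k
      j' = C.next^ (suc Y) fzero
      module Fold = From j'

      closes-forward : Fold.move k' ≡ forward
      closes-forward = begin
        Fold.move k'            ≡⟨ move-rotated fzero (suc Y) k' ⟩
        Start.move (k' + suc Y) ≡⟨ cong Start.move (trans (+-suc k' Y) (+-comm k Y)) ⟩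
        Start.move (Y + k)      ≡⟨ Start.move-period Y ⟩
        Start.move Y            ≡⟨ proj₁ (proj₂ fold) ⟩
        forward                 ∎
        where open ≡-Reasoning

      shape : ∃ λ a' → RectangleWalk Fold.W k a' Fold.s0 Fold.p0
      shape = Fold.Rectangle.rectangle-shape (proj₁ (proj₂ (proj₂ fold))) (proj₂ (proj₂ (proj₂ fold))) closes-forward
      a' : ℕ
      a' = proj₁ shape

      P : Fin M
      P = Fold.p0

      a'≡a : a' ≡ a
      a'≡a = +-double-injective a' a (suc-injective (suc-injective
               (trans (sym (RectangleWalk.length≡ (proj₂ shape))) (trans k≡l+l (cong suc (+-suc a a))))))

      same-edges : ∀ e → (e ∈E S) ⇔ (e ∈E rectangleCycle a P)
      same-edges e = begin
        e ∈E S                                     ≈⟨ cycleEdges e ⟩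
        (∃ λ j → Joins e (w j) (w (next j)))       ≈⟨ C.∃-next⇔∃-next^ w (Joins e) j' ⟩
        Traces Fold.W k e                          ≈⟨ RectangleEdges.edges (proj₂ shape) e ⟩
        RectangleEdge a' P e                       ≡⟨ cong (λ x → RectangleEdge x P e) a'≡a ⟩
        RectangleEdge a P e                        ≈⟨ ∈-rectangleCycle a P e ⟨
        e ∈E rectangleCycle a P                    ∎
        where open ⇔-Reasoning

  even-cycles : ∀ l → 2 ≤ l → l ≤ M → CountIs (IsCycle M (2 * l)) M
  even-cycles (suc zero) (s≤s ()) _
  even-cycles (suc (suc a)) _ l≤M =
    List.tabulate (rectangleCycle (suc a)) , length-tabulate (rectangleCycle (suc a))
    , Unique.tabulate⁺ (rectangleCycle-injective a l≤M) , λ S → mk⇔ listed cycles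
    where
      listed : ∀ {S} → IsCycle M (2 * suc (suc a)) S → S ∈ List.tabulate (rectangleCycle (suc a))
      listed cyc = let P , S≡ = cycle-is-rectangle (suc a) l≤M cyc in
        subst (_∈ _) (sym S≡) (∈-tabulate⁺ {f = rectangleCycle (suc a)} P)
      cycles : ∀ {S} → S ∈ List.tabulate (rectangleCycle (suc a)) → IsCycle M (2 * suc (suc a)) S
      cycles S∈ = let P , S≡ = ∈-tabulate⁻ {f = rectangleCycle (suc a)} S∈ in
        subst (IsCycle M _) (sym S≡) (RectangleCycle.isCycle (suc a) (s≤s z≤n) l≤M P)

  odd-cycles : CountIs (IsCycle M M) 2
  odd-cycles = layerCycle fzero ∷ layerCycle (fsuc fzero) ∷ [] , refl , (distinct ∷ []) ∷ [] ∷ [] , λ S → mk⇔ listed cycles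
    where
      distinct : layerCycle fzero ≢ layerCycle (fsuc fzero)
      distinct e with cong (λ S → lookup (lookup S fzero) fzero) e
      ... | ()
      listed : ∀ {S} → IsCycle M M S → S ∈ layerCycle fzero ∷ layerCycle (fsuc fzero) ∷ []
      listed cyc with cycle-is-layer cyc
      ... | fzero      , S≡ = here S≡
      ... | fsuc fzero , S≡ = there (here S≡)
      cycles : ∀ {S} → S ∈ layerCycle fzero ∷ layerCycle (fsuc fzero) ∷ [] → IsCycle M M S
      cycles (here refl)         = layerCycle-isCycle fzero
      cycles (there (here refl)) = layerCycle-isCycle (fsuc fzero)

theorem4 : ∀ n → 1 ≤ n →
    (∀ l → 2 ≤ l → l ≤ suc (2 * n) →
      CountIs (IsCycle (suc (2 * n)) (2 * l)) (suc (2 * n)))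
    × CountIs (IsCycle (suc (2 * n)) (suc (2 * n))) 2
theorem4 n 1≤n = even-cycles , odd-cycles
  where open Prism n 1≤n
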